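{- Let $\Gamma = (V, E)$ be a finite $d$-regular graph with $d \ge 1$. (a) If $C$ is a total perfect code in $\Gamma$, then for any equitable partition $\pi = \{V_1, \ldots, V_m\}$ of $\Gamma$, either $0$ is an eigenvalue of $A_\pi$ with eigenvector $(k_1, \ldots, k_m)^T$, where $k_i = |V_i \cap C|/|V_i| - 1/d$, or $d$ divides $|V_i|$ for each $i = 1, \ldots, m$. (b) If $C$ is a total perfect code in $\Gamma$ and $d \ge 2$, then $0$ is an eigenvalue of the adjacency matrix of $\Gamma$ and $(k_v)_{v \in V}$ is a corresponding eigenvector, where $k_v = 1 - \frac{1}{d}$ if $v \in C$ and $k_v = -\frac{1}{d}$ if $v \notin C$.
   Context: A total perfect code in $\Gamma$ is a set $C \subseteq V$ such that every vertex of $\Gamma$ is adjacent to exactly one vertex of $C$. An equitable partition of $\Gamma$ is a partition $\pi = \{V_1, \ldots, V_m\}$ of $V$ such that for all $i, j$ the number $b_{ij}$ of neighbours in $V_j$ of a vertex $u \in V_i$ does not depend on the choice of $u \in V_i$; its quotient matrix is $A_\pi = (b_{ij})_{1 \le i, j \le m}$. -}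

module Defs where

open import Data.Nat using (ℕ; zero; suc; _+_)
open import Data.Bool using (Bool; true; false; _∧_; if_then_else_; not)
open import Data.Fin using (Fin; zero; suc; _≟_)
open import Data.Integer using (+_)
open import Data.Rational using (ℚ; _/_; 0ℚ) renaming (_+_ to _+ℚ_; _*_ to _*ℚ_; _-_ to _-ℚ_)
open import Data.Product using (_×_)
open import Relation.Binary.PropositionalEquality using (_≡_)
open import Relation.Nullary using (¬_; does)

sumℕ : ∀ {n} → (Fin n → ℕ) → ℕ
sumℕ {zero} f = 0
sumℕ {suc n} f = f zero + sumℕ (λ i → f (suc i))

sumℚ : ∀ {n} → (Fin n → ℚ) → ℚ
sumℚ {zero} f = 0ℚ
sumℚ {suc n} f = f zero +ℚ sumℚ (λ i → f (suc i))

count : ∀ {n} → (Fin n → Bool) → ℕ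
count P = sumℕ (λ i → if P i then 1 else 0)

ℕtoℚ : ℕ → ℚ
ℕtoℚ a = (+ a) / 1

-- a / b as a rational; only ever used with b ≥ 1 (b = 0 is a junk value)
frac : ℕ → ℕ → ℚ
frac a zero = 0ℚ
frac a (suc b) = (+ a) / suc b

record Graph (n : ℕ) : Set where
  field
    Adj   : Fin n → Fin n → Bool
    symm  : ∀ u v → Adj u v ≡ Adj v u
    irrfl : ∀ v → Adj v v ≡ false
open Graph public

Regular : ∀ {n} → Graph n → ℕ → Set
Regular G d = ∀ v → count (Adj G v) ≡ d

IsTotalPerfectCode : ∀ {n} → Graph n → (Fin n → Bool) → Set
IsTotalPerfectCode G C = ∀ v → count (λ u → Adj G v u ∧ C u) ≡ 1

-- Partition {V_1,…,V_m} of Fin n: part assigns each vertex its (unique) cell;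
-- every cell is nonempty (rep i ∈ V_i); equitability condition.
record EquitablePartition {n : ℕ} (G : Graph n) (m : ℕ) : Set where
  field
    part     : Fin n → Fin m
    rep      : Fin m → Fin n
    rep-part : ∀ i → part (rep i) ≡ i
    equitable : ∀ (j : Fin m) (u v : Fin n) → part u ≡ part v →
      count (λ w → Adj G u w ∧ does (part w ≟ j)) ≡ count (λ w → Adj G v w ∧ does (part w ≟ j))
open EquitablePartition public

inCell : ∀ {n m} {G : Graph n} → EquitablePartition G m → Fin m → Fin n → Bool
inCell π i w = does (part π w ≟ i)

cellSize : ∀ {n m} {G : Graph n} → EquitablePartition G m → Fin m → ℕ
cellSize π i = count (inCell π i)

quotientMatrix : ∀ {n m} {G : Graph n} → EquitablePartition G m → Fin m → Fin m → ℕ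
quotientMatrix {G = G} π i j = count (λ w → Adj G (rep π i) w ∧ inCell π j w)

ZeroEigenvector : ∀ {m} → (Fin m → Fin m → ℚ) → (Fin m → ℚ) → Set
ZeroEigenvector M k = (∀ i → sumℚ (λ j → M i j *ℚ k j) ≡ 0ℚ) × ¬ (∀ i → k i ≡ 0ℚ)

adjℚ : ∀ {n} → Graph n → Fin n → Fin n → ℚ
adjℚ G u v = if Adj G u v then ℕtoℚ 1 else 0ℚ

module Submission where

-- Everything reduces to double counting the ordered adjacent pairs (u, w) with
-- u ∈ P and w ∈ Q (edges P Q): the count is symmetric, equals |P|·k when every
-- vertex of P has k neighbours in Q, and is additive over the cells of a
-- partition.  For an equitable partition with cell sizes s_j, code counts
-- c_j = |V_j ∩ C| and quotient matrix b this yields  Σ_j b_ij = d,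
-- s_i b_ij = s_j b_ji  and  Σ_j c_j b_ji = s_i  (every vertex has exactly one
-- neighbour in C), hence  Σ_j b_ij (c_j/s_j) = 1.  The rational lemma
-- centred-row (Σ a_j f_j = 1 and Σ a_j = d give Σ a_j (f_j - 1/d) = 0) then
-- shows that A_π annihilates k_j = c_j/s_j - 1/d: either k ≠ 0 is an
-- eigenvector for 0, or c_j/s_j = 1/d for all j and d ∣ s_j.  Part (b) is the
-- same row lemma for the adjacency matrix and the indicator of C.

open import Defs
open import Data.Nat using (ℕ; _≤_)
open import Data.Nat.Divisibility using (_∣_)
open import Data.Bool using (Bool; _∧_; if_then_else_)
open import Data.Fin using (Fin)
open import Data.Rational using (ℚ) renaming (_-_ to _-ℚ_)
open import Data.Product using (_×_)
open import Data.Sum using (_⊎_)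

open import Data.Bool using (true; false; T)
open import Data.Fin using (zero; suc; _≟_)
open import Data.Nat as ℕ using (zero; suc; NonZero; s≤s; z≤n)
import Data.Nat.Properties as ℕP
open import Data.Product using (_,_)
open import Data.Sum using (inj₁; inj₂)
open import Function using (_∘_)
open import Relation.Binary.PropositionalEquality
open import Relation.Nullary using (does; yes; no; ¬_)

module NatSums where
  open import Data.Nat using (_+_; _*_)
  open import Algebra.Properties.Semiring.Sum ℕP.+-*-semiring
    using (sum; sum-cong-≗; ∑-comm; *-distribˡ-sum; *-distribʳ-sum; sum-replicate-zero)

  sumℕ≡sum : ∀ {n} (f : Fin n → ℕ) → sumℕ f ≡ sum f
  sumℕ≡sum {zero}  f = refl
  sumℕ≡sum {suc n} f = cong (f zero +_) (sumℕ≡sum (f ∘ suc))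

  sumℕ-cong : ∀ {n} {f g : Fin n → ℕ} → (∀ i → f i ≡ g i) → sumℕ f ≡ sumℕ g
  sumℕ-cong {f = f} {g} f≗g = trans (sumℕ≡sum f) (trans (sum-cong-≗ f≗g) (sym (sumℕ≡sum g)))

  sumℕ-zero : ∀ n → sumℕ {n} (λ _ → 0) ≡ 0
  sumℕ-zero n = trans (sumℕ≡sum {n} (λ _ → 0)) (sum-replicate-zero n)

  sumℕ-*ˡ : ∀ {n} k (f : Fin n → ℕ) → sumℕ (λ i → k * f i) ≡ k * sumℕ f
  sumℕ-*ˡ k f = trans (sumℕ≡sum (λ i → k * f i))
    (trans (sym (*-distribˡ-sum k f)) (cong (k *_) (sym (sumℕ≡sum f))))

  sumℕ-*ʳ : ∀ {n} (f : Fin n → ℕ) k → sumℕ (λ i → f i * k) ≡ sumℕ f * k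
  sumℕ-*ʳ f k = trans (sumℕ≡sum (λ i → f i * k))
    (trans (sym (*-distribʳ-sum k f)) (cong (_* k) (sym (sumℕ≡sum f))))

  sumℕ-comm : ∀ {m n} (f : Fin m → Fin n → ℕ) →
    sumℕ (λ i → sumℕ (f i)) ≡ sumℕ (λ j → sumℕ (λ i → f i j))
  sumℕ-comm f = trans (double f) (trans (∑-comm f) (sym (double (λ j i → f i j))))
    where
    double : ∀ {m n} (g : Fin m → Fin n → ℕ) → sumℕ (λ i → sumℕ (g i)) ≡ sum (λ i → sum (g i))
    double g = trans (sumℕ-cong (λ i → sumℕ≡sum (g i))) (sumℕ≡sum (λ i → sum (g i)))

module Counting where
  open import Data.Nat using (_*_; _<_)
  open NatSums

  ⟦_⟧ : Bool → ℕ
  ⟦ b ⟧ = if b then 1 else 0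

  ⟦∧⟧ : ∀ a b → ⟦ a ∧ b ⟧ ≡ ⟦ a ⟧ * ⟦ b ⟧
  ⟦∧⟧ false b = refl
  ⟦∧⟧ true  b = sym (ℕP.*-identityˡ ⟦ b ⟧)

  count-cong : ∀ {n} {P Q : Fin n → Bool} → (∀ w → P w ≡ Q w) → count P ≡ count Q
  count-cong P≗Q = sumℕ-cong (cong ⟦_⟧ ∘ P≗Q)

  count-∧ˡ : ∀ {n} b (R : Fin n → Bool) → count (λ w → b ∧ R w) ≡ ⟦ b ⟧ * count R
  count-∧ˡ b R = trans (sumℕ-cong (λ w → ⟦∧⟧ b (R w))) (sumℕ-*ˡ ⟦ b ⟧ (λ w → ⟦ R w ⟧))

  count-pos : ∀ {n} (P : Fin n → Bool) v → T (P v) → 0 < count P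
  count-pos P zero    Pv with P zero
  ... | true = s≤s z≤n
  count-pos P (suc v) Pv = ℕP.<-≤-trans (count-pos (P ∘ suc) v Pv) (ℕP.m≤n+m _ ⟦ P zero ⟧)

  count-≟ : ∀ {m} (p : Fin m) → count (λ j → does (p ≟ j)) ≡ 1
  count-≟ {suc m} zero    = cong suc (sumℕ-zero m)
  count-≟         (suc p) = count-≟ p

  sum-over-cells : ∀ {m} (p : Fin m) x → sumℕ (λ j → ⟦ does (p ≟ j) ⟧ * x) ≡ x
  sum-over-cells p x =
    trans (sumℕ-*ʳ (λ j → ⟦ does (p ≟ j) ⟧) x) (trans (cong (_* x) (count-≟ p)) (ℕP.*-identityˡ x))

  count-split : ∀ {n m} (p : Fin n → Fin m) (R : Fin n → Bool) →
    sumℕ (λ j → count (λ w → R w ∧ does (p w ≟ j))) ≡ count R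
  count-split {m = m} p R = begin
    sumℕ (λ j → count (λ w → R w ∧ does (p w ≟ j)))
      ≡⟨ sumℕ-comm (λ j w → ⟦ R w ∧ does (p w ≟ j) ⟧) ⟩
    sumℕ (λ w → sumℕ (λ j → ⟦ R w ∧ does (p w ≟ j) ⟧))
      ≡⟨ sumℕ-cong (λ w → sumℕ-cong {m} (λ j →
           trans (⟦∧⟧ (R w) (does (p w ≟ j))) (ℕP.*-comm ⟦ R w ⟧ _))) ⟩
    sumℕ (λ w → sumℕ (λ j → ⟦ does (p w ≟ j) ⟧ * ⟦ R w ⟧))
      ≡⟨ sumℕ-cong (λ w → sum-over-cells (p w) ⟦ R w ⟧) ⟩
    count R ∎
    where open ≡-Reasoning

  ≟-sound : ∀ {m} {x y : Fin m} → T (does (x ≟ y)) → x ≡ y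
  ≟-sound {x = x} {y} x≟y with x ≟ y | x≟y
  ... | yes x≡y | _ = x≡y

  ≟-complete : ∀ {m} {x y : Fin m} → x ≡ y → T (does (x ≟ y))
  ≟-complete {x = x} {y} x≡y with x ≟ y
  ... | yes _  = _
  ... | no x≢y = x≢y x≡y

module Edges {n} (G : Graph n) where
  open import Data.Nat using (_*_)
  open import Data.Bool.Properties using (∧-comm; ∧-assoc)
  open NatSums
  open Counting

  edges : (Fin n → Bool) → (Fin n → Bool) → ℕ
  edges P Q = sumℕ (λ u → count (λ w → P u ∧ Adj G u w ∧ Q w))

  edges-symm : ∀ P Q → edges P Q ≡ edges Q P
  edges-symm P Q = trans (sumℕ-comm (λ u w → ⟦ P u ∧ Adj G u w ∧ Q w ⟧))
    (sumℕ-cong (λ w → count-cong (λ u → reverse (P u) (Q w) (symm G u w))))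
    where
    reverse : ∀ p q {a b} → a ≡ b → p ∧ a ∧ q ≡ q ∧ b ∧ p
    reverse p q {a} refl = trans (∧-comm p (a ∧ q)) (trans (cong (_∧ p) (∧-comm a q)) (∧-assoc q a p))

  edges-uniform : ∀ P Q k → (∀ u → T (P u) → count (λ w → Adj G u w ∧ Q w) ≡ k) →
    edges P Q ≡ count P * k
  edges-uniform P Q k degree = trans (sumℕ-cong row) (sumℕ-*ʳ (λ u → ⟦ P u ⟧) k)
    where
    weight : ∀ b {x} → (T b → x ≡ k) → ⟦ b ⟧ * x ≡ ⟦ b ⟧ * k
    weight true  x≡k = cong (1 *_) (x≡k _)
    weight false _   = refl
    row : ∀ u → count (λ w → P u ∧ Adj G u w ∧ Q w) ≡ ⟦ P u ⟧ * k
    row u = trans (count-∧ˡ (P u) (λ w → Adj G u w ∧ Q w)) (weight (P u) (degree u))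

  edges-split : ∀ {m} (p : Fin n → Fin m) P Q →
    sumℕ (λ j → edges (λ u → does (p u ≟ j) ∧ P u) Q) ≡ edges P Q
  edges-split p P Q = begin
    sumℕ (λ j → sumℕ (λ u → count (λ w → (cell j u ∧ P u) ∧ R u w)))
      ≡⟨ sumℕ-comm (λ j u → count (λ w → (cell j u ∧ P u) ∧ R u w)) ⟩
    sumℕ (λ u → sumℕ (λ j → count (λ w → (cell j u ∧ P u) ∧ R u w)))
      ≡⟨ sumℕ-cong (λ u → sumℕ-cong (λ j → factor u j)) ⟩
    sumℕ (λ u → sumℕ (λ j → ⟦ cell j u ⟧ * count (λ w → P u ∧ R u w)))
      ≡⟨ sumℕ-cong (λ u → sum-over-cells (p u) _) ⟩
    edges P Q ∎
    where
    open ≡-Reasoning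
    cell : _ → Fin n → Bool
    cell j u = does (p u ≟ j)
    R : Fin n → Fin n → Bool
    R u w = Adj G u w ∧ Q w
    factor : ∀ u j → count (λ w → (cell j u ∧ P u) ∧ R u w) ≡ ⟦ cell j u ⟧ * count (λ w → P u ∧ R u w)
    factor u j = trans (count-cong (λ w → ∧-assoc (cell j u) (P u) (R u w)))
                       (count-∧ˡ (cell j u) (λ w → P u ∧ R u w))

module Partition {n m} {G : Graph n} (π : EquitablePartition G m) where
  open import Data.Nat using (_*_)
  open import Data.Bool.Properties using (T-∧)
  open import Data.Product using (proj₁)
  open import Function using (Equivalence)
  open NatSums
  open Counting
  open Edges G

  neighbours-in-cell : ∀ i j u → T (inCell π i u) →
    count (λ w → Adj G u w ∧ inCell π j w) ≡ quotientMatrix π i j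
  neighbours-in-cell i j u u∈Vᵢ =
    equitable π j u (rep π i) (trans (≟-sound u∈Vᵢ) (sym (rep-part π i)))

  -- cells are nonempty, so cell sizes may serve as denominators
  instance
    cell-nonZero : ∀ {i} → NonZero (cellSize π i)
    cell-nonZero {i} = ℕ.>-nonZero (count-pos (inCell π i) (rep π i) (≟-complete (rep-part π i)))

  quotient-row-sum : ∀ d → Regular G d → ∀ i → sumℕ (quotientMatrix π i) ≡ d
  quotient-row-sum d regular i = trans (count-split (part π) (Adj G (rep π i))) (regular (rep π i))

  -- counting the edges between V_i and V_j from both sides
  cell-balance : ∀ i j →
    cellSize π i * quotientMatrix π i j ≡ cellSize π j * quotientMatrix π j i
  cell-balance i j = begin
    cellSize π i * quotientMatrix π i j
      ≡⟨ edges-uniform (inCell π i) (inCell π j) _ (neighbours-in-cell i j) ⟨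
    edges (inCell π i) (inCell π j)  ≡⟨ edges-symm (inCell π i) (inCell π j) ⟩
    edges (inCell π j) (inCell π i)
      ≡⟨ edges-uniform (inCell π j) (inCell π i) _ (neighbours-in-cell j i) ⟩
    cellSize π j * quotientMatrix π j i ∎
    where open ≡-Reasoning

  -- counting the edges between C and V_i: from C cell by cell, and from V_i,
  -- where every vertex has exactly one neighbour in C
  code-column : ∀ (C : Fin n → Bool) → IsTotalPerfectCode G C → ∀ i →
    sumℕ (λ j → count (λ w → inCell π j w ∧ C w) * quotientMatrix π j i) ≡ cellSize π i
  code-column C perfect i = begin
    sumℕ (λ j → count (λ w → inCell π j w ∧ C w) * quotientMatrix π j i)
      ≡⟨ sumℕ-cong (λ j → edges-uniform (λ u → inCell π j u ∧ C u) (inCell π i) _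
            (λ u u∈Vⱼ∩C → neighbours-in-cell j i u (proj₁ (Equivalence.to T-∧ u∈Vⱼ∩C)))) ⟨
    sumℕ (λ j → edges (λ u → inCell π j u ∧ C u) (inCell π i)) ≡⟨ edges-split (part π) C (inCell π i) ⟩
    edges C (inCell π i)   ≡⟨ edges-symm C (inCell π i) ⟩
    edges (inCell π i) C   ≡⟨ edges-uniform (inCell π i) C 1 (λ u _ → perfect u) ⟩
    cellSize π i * 1       ≡⟨ ℕP.*-identityʳ (cellSize π i) ⟩
    cellSize π i ∎
    where open ≡-Reasoning

-- Fractions a/s of naturals (the `frac` of Defs); equalities between them are
-- decided by integer cross-multiplication after passing to unnormalised ℚᵘ.
module Fractions where
  open import Data.Nat using (_+_; _*_)
  open import Data.Integer as ℤ using (+_)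
  import Data.Integer.Properties as ℤP
  open import Data.Rational as ℚ using (1ℚ; toℚᵘ)
  import Data.Rational.Properties as ℚP
  open import Data.Rational.Unnormalised as ℚᵘ using (mkℚᵘ; *≡*) renaming (_≃_ to _≃ᵘ_)
  import Data.Rational.Unnormalised.Properties as ℚᵘP

  toℚᵘ-frac : ∀ a s → toℚᵘ (frac a (suc s)) ≃ᵘ mkℚᵘ (+ a) s
  toℚᵘ-frac a s = ℚP.toℚᵘ-fromℚᵘ (mkℚᵘ (+ a) s)

  frac-≡ : ∀ a b s t .{{_ : NonZero s}} .{{_ : NonZero t}} → a * t ≡ b * s → frac a s ≡ frac b t
  frac-≡ a b (suc s) (suc t) eq = ℚP.toℚᵘ-injective (begin
    toℚᵘ (frac a (suc s)) ≈⟨ toℚᵘ-frac a s ⟩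
    mkℚᵘ (+ a) s          ≈⟨ *≡* cross ⟩
    mkℚᵘ (+ b) t          ≈⟨ ℚᵘP.≃-sym (toℚᵘ-frac b t) ⟩
    toℚᵘ (frac b (suc t)) ∎)
    where
    open ℚᵘP.≃-Reasoning
    cross : + a ℤ.* + suc t ≡ + b ℤ.* + suc s
    cross = trans (sym (ℤP.pos-* a (suc t))) (trans (cong +_ eq) (ℤP.pos-* b (suc s)))

  frac-≡⁻¹ : ∀ a b s t .{{_ : NonZero s}} .{{_ : NonZero t}} → frac a s ≡ frac b t → a * t ≡ b * s
  frac-≡⁻¹ a b (suc s) (suc t) eq
    with ℚᵘP.≃-trans (ℚᵘP.≃-sym (toℚᵘ-frac a s)) (ℚᵘP.≃-trans (ℚP.toℚᵘ-cong eq) (toℚᵘ-frac b t))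
  ... | *≡* cross = ℤP.+-injective (trans (ℤP.pos-* a (suc t)) (trans cross (sym (ℤP.pos-* b (suc s)))))

  frac-self : ∀ a .{{_ : NonZero a}} → frac a a ≡ 1ℚ
  frac-self a = frac-≡ a 1 a 1 (ℕP.*-comm a 1)

  -- the integer identity behind adding fractions with a common denominator
  common-denominator : ∀ a b S → (+ a ℤ.* + S ℤ.+ + b ℤ.* + S) ℤ.* + S ≡ + (a + b) ℤ.* + (S * S)
  common-denominator a b S = begin
    (+ a ℤ.* + S ℤ.+ + b ℤ.* + S) ℤ.* + S ≡⟨ cong (ℤ._* + S) (sym (ℤP.*-distribʳ-+ (+ S) (+ a) (+ b))) ⟩
    (+ a ℤ.+ + b) ℤ.* + S ℤ.* + S         ≡⟨ ℤP.*-assoc (+ a ℤ.+ + b) (+ S) (+ S) ⟩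
    (+ a ℤ.+ + b) ℤ.* (+ S ℤ.* + S)       ≡⟨ cong₂ ℤ._*_ (sym (ℤP.pos-+ a b)) (sym (ℤP.pos-* S S)) ⟩
    + (a + b) ℤ.* + (S * S)                ∎
    where open ≡-Reasoning

  frac-+ : ∀ a b s .{{_ : NonZero s}} → frac a s ℚ.+ frac b s ≡ frac (a + b) s
  frac-+ a b (suc s) = ℚP.toℚᵘ-injective (begin
    toℚᵘ (frac a (suc s) ℚ.+ frac b (suc s))          ≈⟨ ℚP.toℚᵘ-homo-+ (frac a (suc s)) (frac b (suc s)) ⟩
    toℚᵘ (frac a (suc s)) ℚᵘ.+ toℚᵘ (frac b (suc s)) ≈⟨ ℚᵘP.+-cong (toℚᵘ-frac a s) (toℚᵘ-frac b s) ⟩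
    mkℚᵘ (+ a) s ℚᵘ.+ mkℚᵘ (+ b) s                    ≈⟨ *≡* (common-denominator a b (suc s)) ⟩
    mkℚᵘ (+ (a + b)) s                                 ≈⟨ ℚᵘP.≃-sym (toℚᵘ-frac (a + b) s) ⟩
    toℚᵘ (frac (a + b) (suc s))                        ∎)
    where open ℚᵘP.≃-Reasoning

  ℕtoℚ-*-frac : ∀ a b t .{{_ : NonZero t}} → ℕtoℚ a ℚ.* frac b t ≡ frac (a * b) t
  ℕtoℚ-*-frac a b (suc t) = ℚP.toℚᵘ-injective (begin
    toℚᵘ (ℕtoℚ a ℚ.* frac b (suc t))          ≈⟨ ℚP.toℚᵘ-homo-* (ℕtoℚ a) (frac b (suc t)) ⟩
    toℚᵘ (ℕtoℚ a) ℚᵘ.* toℚᵘ (frac b (suc t)) ≈⟨ ℚᵘP.*-cong (toℚᵘ-frac a 0) (toℚᵘ-frac b t) ⟩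
    mkℚᵘ (+ a) 0 ℚᵘ.* mkℚᵘ (+ b) t            ≈⟨ *≡* numerators ⟩
    mkℚᵘ (+ (a * b)) t                         ≈⟨ ℚᵘP.≃-sym (toℚᵘ-frac (a * b) t) ⟩
    toℚᵘ (frac (a * b) (suc t))                ∎)
    where
    open ℚᵘP.≃-Reasoning
    numerators : (+ a ℤ.* + b) ℤ.* + suc t ≡ + (a * b) ℤ.* + (1 * suc t)
    numerators = cong₂ ℤ._*_ (sym (ℤP.pos-* a b)) (cong +_ (sym (ℕP.*-identityˡ (suc t))))

  sumℚ-frac : ∀ {m} (x : Fin m → ℕ) s .{{_ : NonZero s}} → sumℚ (λ j → frac (x j) s) ≡ frac (sumℕ x) s
  sumℚ-frac {zero}  x s = frac-≡ 0 0 1 s refl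
  sumℚ-frac {suc m} x s = trans (cong (frac (x zero) s ℚ.+_) (sumℚ-frac (x ∘ suc) s)) (frac-+ (x zero) _ s)

  sumℚ-ℕtoℚ : ∀ {m} (x : Fin m → ℕ) → sumℚ (λ j → ℕtoℚ (x j)) ≡ ℕtoℚ (sumℕ x)
  sumℚ-ℕtoℚ x = sumℚ-frac x 1

  ℕtoℚ-*-inverse : ∀ d .{{_ : NonZero d}} → ℕtoℚ d ℚ.* frac 1 d ≡ 1ℚ
  ℕtoℚ-*-inverse d = trans (ℕtoℚ-*-frac d 1 d) (trans (cong (λ a → frac a d) (ℕP.*-identityʳ d)) (frac-self d))

  frac≡unit⇒∣ : ∀ c s d .{{_ : NonZero s}} .{{_ : NonZero d}} → frac c s ≡ frac 1 d → d ∣ s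
  frac≡unit⇒∣ c s d eq = divides c (sym (trans (frac-≡⁻¹ c 1 s d eq) (ℕP.*-identityˡ s)))
    where open import Data.Nat.Divisibility using (divides)

  ℕtoℚ≢unit : ∀ a d .{{_ : NonZero d}} → 2 ≤ d → ℕtoℚ a ≢ frac 1 d
  ℕtoℚ≢unit a d 1<d eq = ℕP.<⇒≢ 1<d (sym (ℕP.m*n≡1⇒n≡1 a d (frac-≡⁻¹ a 1 1 d eq)))

module RationalSums where
  open import Algebra.Bundles using (Ring)
  open import Data.Rational using (0ℚ; 1ℚ; _+_; _*_; _-_; -_)
  import Data.Rational.Properties as ℚP
  open import Algebra.Properties.Semiring.Sum (Ring.semiring ℚP.+-*-ring)
    using (sum; sum-cong-≗; ∑-distrib-+; *-distribʳ-sum)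

  sumℚ≡sum : ∀ {n} (f : Fin n → ℚ) → sumℚ f ≡ sum f
  sumℚ≡sum {zero}  f = refl
  sumℚ≡sum {suc n} f = cong (f zero +_) (sumℚ≡sum (f ∘ suc))

  sumℚ-cong : ∀ {n} {f g : Fin n → ℚ} → (∀ i → f i ≡ g i) → sumℚ f ≡ sumℚ g
  sumℚ-cong {f = f} {g} f≗g = trans (sumℚ≡sum f) (trans (sum-cong-≗ f≗g) (sym (sumℚ≡sum g)))

  sumℚ-+ : ∀ {n} (f g : Fin n → ℚ) → sumℚ (λ i → f i + g i) ≡ sumℚ f + sumℚ g
  sumℚ-+ f g = trans (sumℚ≡sum (λ i → f i + g i))
    (trans (∑-distrib-+ f g) (sym (cong₂ _+_ (sumℚ≡sum f) (sumℚ≡sum g))))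

  sumℚ-*ʳ : ∀ {n} (f : Fin n → ℚ) r → sumℚ (λ i → f i * r) ≡ sumℚ f * r
  sumℚ-*ʳ f r = trans (sumℚ≡sum (λ i → f i * r))
    (trans (sym (*-distribʳ-sum r f)) (cong (_* r) (sym (sumℚ≡sum f))))

  centred-row : ∀ {m} (a f : Fin m → ℚ) D δ →
    sumℚ (λ j → a j * f j) ≡ 1ℚ → sumℚ a ≡ D → D * δ ≡ 1ℚ →
    sumℚ (λ j → a j * (f j - δ)) ≡ 0ℚ
  centred-row a f D δ af≡1 a≡D Dδ≡1 = begin
    sumℚ (λ j → a j * (f j - δ))            ≡⟨ sumℚ-cong (λ j → ℚP.*-distribˡ-+ (a j) (f j) (- δ)) ⟩
    sumℚ (λ j → a j * f j + a j * - δ)      ≡⟨ sumℚ-+ (λ j → a j * f j) (λ j → a j * - δ) ⟩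
    sumℚ (λ j → a j * f j) + sumℚ (λ j → a j * - δ)
                                             ≡⟨ cong₂ _+_ af≡1 (trans (sumℚ-*ʳ a (- δ)) (cong (_* - δ) a≡D)) ⟩
    1ℚ + D * - δ                             ≡⟨ cong (1ℚ +_) (ℚP.neg-distribʳ-* D δ) ⟨
    1ℚ - D * δ                               ≡⟨ cong (λ x → 1ℚ - x) Dδ≡1 ⟩
    1ℚ - 1ℚ                                  ≡⟨ ℚP.+-inverseʳ 1ℚ ⟩
    0ℚ                                       ∎
    where open ≡-Reasoning

open import Data.Fin.Properties using (all?)
open import Data.Nat.Solver using (module +-*-Solver)
open import Data.Rational using (0ℚ; 1ℚ; _*_)
import Data.Rational.Properties as ℚP
open import Algebra.Properties.Group ℚP.+-0-group using (x∙y⁻¹≈ε⇒x≈y)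
open Counting using (⟦_⟧; ⟦∧⟧)
open Partition
open Fractions
open RationalSums

density : ∀ {n m} {G : Graph n} → EquitablePartition G m → (Fin n → Bool) → Fin m → ℚ
density π C j = frac (count (λ w → inCell π j w ∧ C w)) (cellSize π j)

-- Row i of A_π maps the densities to 1: multiplying by |V_i|, the row becomes
-- Σ_j c_j b_ji / |V_i| = 1 by the balance and code-column identities.
density-row : ∀ {n m} {G : Graph n} (π : EquitablePartition G m) (C : Fin n → Bool) →
  IsTotalPerfectCode G C → ∀ i → sumℚ (λ j → ℕtoℚ (quotientMatrix π i j) * density π C j) ≡ 1ℚ
density-row π C perfect i = begin
  sumℚ (λ j → ℕtoℚ (b i j) * frac (c j) (s j))
    ≡⟨ sumℚ-cong (λ j → trans (ℕtoℚ-*-frac (b i j) (c j) (s j)) (frac-≡ _ _ (s j) (s i) (transfer j))) ⟩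
  sumℚ (λ j → frac (c j ℕ.* b j i) (s i))  ≡⟨ sumℚ-frac (λ j → c j ℕ.* b j i) (s i) ⟩
  frac (sumℕ (λ j → c j ℕ.* b j i)) (s i)  ≡⟨ cong (λ x → frac x (s i)) (code-column π C perfect i) ⟩
  frac (s i) (s i)                          ≡⟨ frac-self (s i) ⟩
  1ℚ                                        ∎
  where
  open ≡-Reasoning
  open Partition π using (cell-nonZero)
  open +-*-Solver using (solve; _:*_; _:=_)
  b = quotientMatrix π
  s = cellSize π
  c : _ → ℕ
  c j = count (λ w → inCell π j w ∧ C w)
  transfer : ∀ j → b i j ℕ.* c j ℕ.* s i ≡ c j ℕ.* b j i ℕ.* s j
  transfer j = begin
    b i j ℕ.* c j ℕ.* s i   ≡⟨ solve 3 (λ x y z → x :* y :* z := y :* (z :* x)) refl (b i j) (c j) (s i) ⟩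
    c j ℕ.* (s i ℕ.* b i j) ≡⟨ cong (c j ℕ.*_) (cell-balance π i j) ⟩
    c j ℕ.* (s j ℕ.* b j i) ≡⟨ solve 3 (λ x y z → x :* (y :* z) := x :* z :* y) refl (c j) (s j) (b j i) ⟩
    c j ℕ.* b j i ℕ.* s j   ∎

quotient-dichotomy : ∀ {n m d} .{{_ : NonZero d}} {G : Graph n} → Regular G d →
  (C : Fin n → Bool) → IsTotalPerfectCode G C → (π : EquitablePartition G m) →
  ZeroEigenvector (λ i j → ℕtoℚ (quotientMatrix π i j)) (λ i → density π C i -ℚ frac 1 d)
  ⊎ (∀ i → d ∣ cellSize π i)
quotient-dichotomy {d = d} regular C perfect π with all? (λ i → density π C i -ℚ frac 1 d ℚP.≟ 0ℚ)
... | yes k≡0 = inj₂ (λ i → frac≡unit⇒∣ _ (cellSize π i) d (x∙y⁻¹≈ε⇒x≈y _ _ (k≡0 i)))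
  where open Partition π using (cell-nonZero)
... | no  k≢0 = inj₁ (kernel , k≢0)
  where
  kernel : ∀ i → sumℚ (λ j → ℕtoℚ (quotientMatrix π i j) * (density π C j -ℚ frac 1 d)) ≡ 0ℚ
  kernel i = centred-row (ℕtoℚ ∘ quotientMatrix π i) (density π C) (ℕtoℚ d) (frac 1 d)
    (density-row π C perfect i)
    (trans (sumℚ-ℕtoℚ (quotientMatrix π i)) (cong ℕtoℚ (quotient-row-sum π d regular i)))
    (ℕtoℚ-*-inverse d)

indicator : ∀ {n} → (Fin n → Bool) → Fin n → ℚ
indicator C v = if C v then ℕtoℚ 1 else ℕtoℚ 0

indicator-ℕtoℚ : ∀ b → (if b then ℕtoℚ 1 else ℕtoℚ 0) ≡ ℕtoℚ ⟦ b ⟧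
indicator-ℕtoℚ true  = refl
indicator-ℕtoℚ false = refl

-- Part (b): each row of the adjacency matrix has sum d and meets C exactly once,
-- so it annihilates 1_C - 1/d.
adjacency-kernel : ∀ {n d} .{{_ : NonZero d}} (G : Graph n) → Regular G d →
  (C : Fin n → Bool) → IsTotalPerfectCode G C →
  ∀ u → sumℚ (λ v → adjℚ G u v * (indicator C v -ℚ frac 1 d)) ≡ 0ℚ
adjacency-kernel {d = d} G regular C perfect u = centred-row (adjℚ G u) (indicator C) (ℕtoℚ d) (frac 1 d)
  (trans (sumℚ-cong meets-C) (trans (sumℚ-ℕtoℚ (λ v → ⟦ Adj G u v ∧ C v ⟧)) (cong ℕtoℚ (perfect u))))
  (trans (sumℚ-cong (indicator-ℕtoℚ ∘ Adj G u)) (trans (sumℚ-ℕtoℚ (λ v → ⟦ Adj G u v ⟧)) (cong ℕtoℚ (regular u))))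
  (ℕtoℚ-*-inverse d)
  where
  meets-C : ∀ v → adjℚ G u v * indicator C v ≡ ℕtoℚ ⟦ Adj G u v ∧ C v ⟧
  meets-C v = trans (cong₂ _*_ (indicator-ℕtoℚ (Adj G u v)) (indicator-ℕtoℚ (C v)))
    (trans (ℕtoℚ-*-frac ⟦ Adj G u v ⟧ ⟦ C v ⟧ 1) (cong ℕtoℚ (sym (⟦∧⟧ (Adj G u v) (C v)))))

-- For d ≥ 2 no entry of 1_C - 1/d vanishes, as 1/d is neither 0 nor 1.
indicator-centred-nonzero : ∀ {n d} .{{_ : NonZero d}} (C : Fin n → Bool) → 2 ≤ d → 1 ≤ n →
  ¬ (∀ v → indicator C v -ℚ frac 1 d ≡ 0ℚ)
indicator-centred-nonzero {d = d} C 2≤d (s≤s z≤n) centred≡0 = ℕtoℚ≢unit ⟦ C zero ⟧ d 2≤d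
  (trans (sym (indicator-ℕtoℚ (C zero))) (x∙y⁻¹≈ε⇒x≈y _ _ (centred≡0 zero)))

corollary5p4 : (n d : ℕ) → 1 ≤ d → (G : Graph n) → Regular G d →
    (C : Fin n → Bool) → IsTotalPerfectCode G C →
    ((m : ℕ) → (π : EquitablePartition G m) →
      ZeroEigenvector (λ i j → ℕtoℚ (quotientMatrix π i j))
        (λ i → frac (count (λ w → inCell π i w ∧ C w)) (cellSize π i) -ℚ frac 1 d)
      ⊎ (∀ i → d ∣ cellSize π i))
    × (2 ≤ d → 1 ≤ n →
      ZeroEigenvector (adjℚ G) (λ v → (if C v then ℕtoℚ 1 else ℕtoℚ 0) -ℚ frac 1 d))
corollary5p4 n (suc d) (s≤s z≤n) G regular C perfect =
    (λ m π → quotient-dichotomy regular C perfect π)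
  , (λ 2≤d 1≤n → adjacency-kernel G regular C perfect , indicator-centred-nonzero C 2≤d 1≤n)
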